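{- Let $h_1,\dots,h_k$ be positive integers, let $m\in[k]$, and let $a,b\geq 0$ be integers with $h_m-a\geq 1$. Let $P_1=(h_1,\dots,h_{m-1},h_m-a,h_{m+1},\dots,h_k)$ and $P_2=(h_1,\dots,h_{m-1},h_m+b,h_{m+1},\dots,h_k)$ (parts not required to be in non-increasing order). If an $\mathrm{LS}(P_1)$ and an $\mathrm{LS}(P_2)$ exist, then an $\mathrm{ROS}(h_1\dots h_k)$ exists.
   Context: For positive integers $g_1,\dots,g_k$ with $n=\sum_i g_i$, an $\mathrm{LS}(g_1\dots g_k)$ is a latin square of order $n$ containing $k$ pairwise disjoint subsquares of orders $g_1,\dots,g_k$ (a subsquare is a square subarray which is itself a latin square; disjoint means sharing no rows, columns or symbols). Given a sequence $P=(p_1,\dots,p_k)$ of positive integers, an $\mathrm{ROS}(P)$ is an assignment of a non-negative rational number $O(i,j,\ell)$ to every multiset $\{i,j,\ell\}$ of elements of $[k]$ (invariant under permuting $i,j,\ell$) such that $\sum_{\ell\in[k]}O(i,j,\ell)=p_ip_j$ for all $i,j\in[k]$, and $O(i,i,i)=p_i^2$ and $O(i,i,j)=0$ for all $i\neq j$. -}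

module Defs where

open import Data.Nat using (ℕ; zero; suc; _+_; _≤_)
import Data.Nat as ℕ
open import Data.Fin using (Fin; zero; suc)
open import Data.Integer using (+_)
open import Data.Rational using (ℚ; 0ℚ; _/_)
import Data.Rational as ℚ
open import Data.Product using (Σ; ∃; _×_)
open import Relation.Binary.PropositionalEquality using (_≡_; _≢_)
open import Function.Definitions using (Injective)

sumℕ : ∀ {k} → (Fin k → ℕ) → ℕ
sumℕ {zero}  f = 0
sumℕ {suc k} f = f zero + sumℕ (λ i → f (suc i))

sumℚ : ∀ {k} → (Fin k → ℚ) → ℚ
sumℚ {zero}  f = 0ℚ
sumℚ {suc k} f = f zero ℚ.+ sumℚ (λ i → f (suc i))

ℕtoℚ : ℕ → ℚ
ℕtoℚ n = + n / 1

IsLatin : ∀ {n} → (Fin n → Fin n → Fin n) → Set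
IsLatin {n} L =
  (∀ r → Injective _≡_ _≡_ (L r)) × (∀ c → Injective _≡_ _≡_ (λ r → L r c))

-- A subsquare of order g of L: a set of g rows, g columns and g symbols
-- (given by injective enumerations) such that every cell of the g×g subarray
-- contains one of the g symbols, i.e. the subarray is a latin square on them.
record Subsquare {n : ℕ} (L : Fin n → Fin n → Fin n) (g : ℕ) : Set where
  field
    rows cols syms : Fin g → Fin n
    rows-inj : Injective _≡_ _≡_ rows
    cols-inj : Injective _≡_ _≡_ cols
    syms-inj : Injective _≡_ _≡_ syms
    closed   : ∀ x y → ∃ λ z → L (rows x) (cols y) ≡ syms z
open Subsquare public

Disjoint : ∀ {n} {L : Fin n → Fin n → Fin n} {g h : ℕ} →
           Subsquare L g → Subsquare L h → Set
Disjoint S T =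
  (∀ x y → rows S x ≢ rows T y) ×
  (∀ x y → cols S x ≢ cols T y) ×
  (∀ x y → syms S x ≢ syms T y)

record LS {k : ℕ} (g : Fin k → ℕ) : Set where
  field
    square   : Fin (sumℕ g) → Fin (sumℕ g) → Fin (sumℕ g)
    latin    : IsLatin square
    sub      : (i : Fin k) → Subsquare square (g i)
    disjoint : ∀ i j → i ≢ j → Disjoint (sub i) (sub j)

-- ROS(p_1 … p_k): a non-negative rational function on multisets {i,j,ℓ}
-- (a function of triples invariant under permutations).
record ROS {k : ℕ} (p : Fin k → ℕ) : Set where
  field
    O        : Fin k → Fin k → Fin k → ℚ
    sym₁₂    : ∀ i j l → O i j l ≡ O j i l
    sym₂₃    : ∀ i j l → O i j l ≡ O i l j
    nonneg   : ∀ i j l → 0ℚ ℚ.≤ O i j l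
    rowsum   : ∀ i j → sumℚ (λ l → O i j l) ≡ ℕtoℚ (p i ℕ.* p j)
    diag     : ∀ i → O i i i ≡ ℕtoℚ (p i ℕ.* p i)
    offdiag  : ∀ i j → i ≢ j → O i i j ≡ 0ℚ

{-# OPTIONS --safe #-}
-- Given an LS(g), let N(i, j, l) count the cells lying in the rows of the i-th subsquare
-- and the columns of the j-th whose symbol belongs to the l-th.  The rows, columns and
-- symbols of the subsquares partition those of the square, and every row and column of a
-- latin square is a permutation of the symbols, so each of the three line sums of N is a
-- product g_a g_b; moreover N(i, i, i) = g_i².  Summing N over the six permutations of its
-- arguments and dividing by 6 gives an ROS(g).
-- The two given squares have the same parts except at m, and
-- b (h_m - a) + a (h_m + b) = (a + b) h_m, so (b O₁ + a O₂) / (a + b) has line sums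
-- h_i h_j whenever i ≠ j; resetting the entries O(i, i, i) to h_i² gives an ROS(h).

module Submission where

open import Defs
open import Data.Nat
  using (ℕ; zero; suc; _+_; _*_; _∸_; _≤_; _≤?_; z≤n; s≤s; NonZero; ≢-nonZero)
open import Data.Nat.Properties
  using ( +-*-semiring; +-identityʳ; *-identityʳ; *-zeroʳ; *-comm; *-assoc; *-distribʳ-+
        ; ≤-antisym; +-mono-≤; +-monoʳ-≤; +-cancelʳ-≤; +-cancelˡ-≡; m≤m+n; <⇒≤; ≰⇒>
        ; n<1⇒n≡0; n>0⇒n≢0; m+n≡0⇒m≡0; m+n≡0⇒n≡0; m∸n≢0⇒n<m; m+n∸m≡n; m≤n⇒∃[o]m+o≡n
        ; m*n≢0; m+1+n≢0
        ; module ≤-Reasoning )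
open import Data.Nat.Tactic.RingSolver using (solve-∀)
open import Data.Fin using (Fin; zero; suc; _≟_; punchIn; punchOut)
open import Data.Fin.Properties using (suc-injective; 0≢1+n; punchIn-punchOut; punchInᵢ≢i; any?)
open import Data.Vec.Functional using (updateAt; removeAt)
open import Data.Vec.Functional.Properties using (updateAt-updates; updateAt-minimal)
open import Data.Product using (∃; _×_; _,_; proj₁; proj₂)
import Data.Integer as ℤ
import Data.Integer.Properties as ℤₚ
open import Data.Rational using (ℚ; toℚᵘ; 1/_)
import Data.Rational as ℚ
import Data.Rational.Properties as ℚ
open import Data.Rational.Unnormalised using (ℚᵘ; mkℚᵘ)
import Data.Rational.Unnormalised as ℚᵘ
import Data.Rational.Unnormalised.Properties as ℚᵘ
open import Function using (_∘_)
open import Function.Definitions using (Injective)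
open import Relation.Nullary using (¬_; Dec; yes; no; contradiction)
open import Relation.Nullary.Decidable using (_×-dec_; decidable-stable)
open import Relation.Binary.PropositionalEquality
open import Algebra.Properties.Semiring.Sum +-*-semiring
  using ( sum; sum-syntax; sum-cong-≗; sum-replicate-zero; sum-remove; ∑-comm; ∑-distrib-+
        ; *-distribˡ-sum; *-distribʳ-sum )

sumℕ≡sum : ∀ {k} (f : Fin k → ℕ) → sumℕ f ≡ sum f
sumℕ≡sum {zero}  f = refl
sumℕ≡sum {suc k} f = cong (f zero +_) (sumℕ≡sum (f ∘ suc))

∑-const : ∀ n c → ∑[ i < n ] c ≡ n * c
∑-const zero    c = refl
∑-const (suc n) c = cong (c +_) (∑-const n c)

∑∑-one : ∀ a b → ∑[ x < a ] ∑[ y < b ] 1 ≡ a * b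
∑∑-one a b = begin
  ∑[ x < a ] ∑[ y < b ] 1  ≡⟨ sum-cong-≗ {a} (λ _ → trans (∑-const b 1) (*-identityʳ b)) ⟩
  ∑[ x < a ] b             ≡⟨ ∑-const a b ⟩
  a * b                    ∎
  where open ≡-Reasoning

sum-zero : ∀ {k} (f : Fin k → ℕ) → (∀ i → f i ≡ 0) → sum f ≡ 0
sum-zero {k} f f≡0 = trans (sum-cong-≗ f≡0) (sum-replicate-zero k)

sum≡0⇒≡0 : ∀ {k} (f : Fin k → ℕ) → sum f ≡ 0 → ∀ i → f i ≡ 0
sum≡0⇒≡0 f Σf≡0 zero    = m+n≡0⇒m≡0 (f zero) Σf≡0
sum≡0⇒≡0 f Σf≡0 (suc i) = sum≡0⇒≡0 (f ∘ suc) (m+n≡0⇒n≡0 (f zero) Σf≡0) i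

∑-single : ∀ {k} (f : Fin k → ℕ) i → (∀ j → j ≢ i → f j ≡ 0) → sum f ≡ f i
∑-single {suc k} f i f≡0 = begin
  sum f                     ≡⟨ sum-remove f ⟩
  f i + sum (removeAt f i)  ≡⟨ cong (f i +_) (sum-zero _ (λ j → f≡0 (punchIn i j) (punchInᵢ≢i i j))) ⟩
  f i + 0                   ≡⟨ +-identityʳ (f i) ⟩
  f i                       ∎
  where open ≡-Reasoning

sum≡term⇒≡0 : ∀ {k} (f : Fin k → ℕ) i → sum f ≡ f i → ∀ j → j ≢ i → f j ≡ 0
sum≡term⇒≡0 {suc k} f i Σf≡fi j j≢i = begin
  f j                                  ≡⟨ cong f (punchIn-punchOut (≢-sym j≢i)) ⟨
  removeAt f i (punchOut (≢-sym j≢i))  ≡⟨ sum≡0⇒≡0 (removeAt f i) rest≡0 _ ⟩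
  0                                    ∎
  where
  open ≡-Reasoning
  rest≡0 : sum (removeAt f i) ≡ 0
  rest≡0 = +-cancelˡ-≡ (f i) _ _
    (trans (sym (sum-remove f)) (trans Σf≡fi (sym (+-identityʳ (f i)))))

sum≤length : ∀ {k} (f : Fin k → ℕ) → (∀ i → f i ≤ 1) → sum f ≤ k
sum≤length {zero}  f f≤1 = z≤n
sum≤length {suc k} f f≤1 = +-mono-≤ (f≤1 zero) (sum≤length (f ∘ suc) (f≤1 ∘ suc))

all≡1 : ∀ {k} (f : Fin k → ℕ) → (∀ i → f i ≤ 1) → sum f ≡ k → ∀ i → f i ≡ 1
all≡1 {suc k} f f≤1 Σf≡k i = ≤-antisym (f≤1 i) (+-cancelʳ-≤ k 1 (f i) (begin
  suc k                     ≡⟨ Σf≡k ⟨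
  sum f                     ≡⟨ sum-remove f ⟩
  f i + sum (removeAt f i)  ≤⟨ +-monoʳ-≤ (f i) (sum≤length _ (f≤1 ∘ punchIn i)) ⟩
  f i + k                   ∎))
  where open ≤-Reasoning

sum≤1 : ∀ {k} (f : Fin k → ℕ) → (∀ i → f i ≤ 1) →
        (∀ i j → 1 ≤ f i → 1 ≤ f j → i ≡ j) → sum f ≤ 1
sum≤1 {zero}  f f≤1 unique = z≤n
sum≤1 {suc k} f f≤1 unique with 1 ≤? f zero
... | no 1≰f0 rewrite n<1⇒n≡0 (≰⇒> 1≰f0) =
  sum≤1 (f ∘ suc) (f≤1 ∘ suc) (λ i j p q → suc-injective (unique (suc i) (suc j) p q))
... | yes 1≤f0 = begin
  f zero + sum (f ∘ suc)  ≡⟨ cong (f zero +_) (sum-zero (f ∘ suc) tail≡0) ⟩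
  f zero + 0              ≡⟨ +-identityʳ (f zero) ⟩
  f zero                  ≤⟨ f≤1 zero ⟩
  1                       ∎
  where
  open ≤-Reasoning
  tail≡0 : ∀ i → f (suc i) ≡ 0
  tail≡0 i = n<1⇒n≡0 (≰⇒> (λ 1≤fi → 0≢1+n (unique zero (suc i) 1≤f0 1≤fi)))

sum-pos⇒∃ : ∀ {k} (f : Fin k → ℕ) → 1 ≤ sum f → ∃ λ i → 1 ≤ f i
sum-pos⇒∃ f 1≤Σf = decidable-stable (any? (λ i → 1 ≤? f i)) λ ¬∃ →
  1≰0 (subst (1 ≤_) (sum-zero f (λ i → n<1⇒n≡0 (≰⇒> (λ 1≤fi → ¬∃ (i , 1≤fi))))) 1≤Σf)
  where
  1≰0 : ¬ (1 ≤ 0)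
  1≰0 ()

δ : ∀ {n} → Fin n → Fin n → ℕ
δ zero    zero    = 1
δ zero    (suc _) = 0
δ (suc _) zero    = 0
δ (suc x) (suc y) = δ x y

δ-refl : ∀ {n} (x : Fin n) → δ x x ≡ 1
δ-refl zero    = refl
δ-refl (suc x) = δ-refl x

δ≤1 : ∀ {n} (x y : Fin n) → δ x y ≤ 1
δ≤1 zero    zero    = s≤s z≤n
δ≤1 zero    (suc _) = z≤n
δ≤1 (suc _) zero    = z≤n
δ≤1 (suc x) (suc y) = δ≤1 x y

δ-pos⇒≡ : ∀ {n} {x y : Fin n} → 1 ≤ δ x y → x ≡ y
δ-pos⇒≡ {x = zero}  {zero}  _ = refl
δ-pos⇒≡ {x = suc x} {suc y} p = cong suc (δ-pos⇒≡ p)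

∑-δ-* : ∀ {n} (x : Fin n) (F : Fin n → ℕ) → ∑[ y < n ] (δ x y * F y) ≡ F x
∑-δ-* {suc n} zero    F =
  trans (cong₂ _+_ (+-identityʳ (F zero)) (sum-replicate-zero n)) (+-identityʳ (F zero))
∑-δ-* {suc n} (suc x) F = ∑-δ-* x (F ∘ suc)

fibreSize : ∀ {m n} → (Fin m → Fin n) → Fin n → ℕ
fibreSize {m} f s = ∑[ z < m ] δ (f z) s

∑-fibreSize-* : ∀ {m n} (f : Fin m → Fin n) (F : Fin n → ℕ) →
                ∑[ z < m ] F (f z) ≡ ∑[ s < n ] (fibreSize f s * F s)
∑-fibreSize-* {m} {n} f F = begin
  ∑[ z < m ] F (f z)
    ≡⟨ sum-cong-≗ (λ z → ∑-δ-* (f z) F) ⟨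
  ∑[ z < m ] ∑[ s < n ] (δ (f z) s * F s)
    ≡⟨ ∑-comm (λ z s → δ (f z) s * F s) ⟩
  ∑[ s < n ] ∑[ z < m ] (δ (f z) s * F s)
    ≡⟨ sum-cong-≗ (λ s → *-distribʳ-sum (F s) (λ z → δ (f z) s)) ⟨
  ∑[ s < n ] (fibreSize f s * F s) ∎
  where open ≡-Reasoning

∑-fibreSize : ∀ {m n} (f : Fin m → Fin n) → ∑[ s < n ] fibreSize f s ≡ m
∑-fibreSize {m} {n} f = begin
  ∑[ s < n ] fibreSize f s          ≡⟨ sum-cong-≗ (λ s → *-identityʳ (fibreSize f s)) ⟨
  ∑[ s < n ] (fibreSize f s * 1)    ≡⟨ ∑-fibreSize-* f (λ _ → 1) ⟨
  ∑[ z < m ] 1                      ≡⟨ ∑-const m 1 ⟩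
  m * 1                             ≡⟨ *-identityʳ m ⟩
  m                                 ∎
  where open ≡-Reasoning

fibreSize≤1 : ∀ {m n} (f : Fin m → Fin n) → Injective _≡_ _≡_ f →
              ∀ s → fibreSize f s ≤ 1
fibreSize≤1 f f-inj s = sum≤1 (λ z → δ (f z) s) (λ z → δ≤1 (f z) s)
  (λ z w p q → f-inj (trans (δ-pos⇒≡ p) (sym (δ-pos⇒≡ q))))

fibreSize-pos⇒∃ : ∀ {m n} (f : Fin m → Fin n) s → 1 ≤ fibreSize f s → ∃ λ z → f z ≡ s
fibreSize-pos⇒∃ f s p = let z , q = sum-pos⇒∃ (λ z → δ (f z) s) p in z , δ-pos⇒≡ q

fibreSize-image : ∀ {m n} (f : Fin m → Fin n) → Injective _≡_ _≡_ f →
                  ∀ z → fibreSize f (f z) ≡ 1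
fibreSize-image {suc m} f f-inj z = ≤-antisym (fibreSize≤1 f f-inj (f z)) (begin
  1                                   ≡⟨ δ-refl (f z) ⟨
  δ (f z) (f z)                       ≤⟨ m≤m+n _ _ ⟩
  δ (f z) (f z) + sum (removeAt δz z)  ≡⟨ sum-remove δz ⟨
  fibreSize f (f z)                   ∎)
  where
  open ≤-Reasoning
  δz : Fin (suc m) → ℕ
  δz w = δ (f w) (f z)

∑-reindex : ∀ {m n} (f : Fin m → Fin n) → (∀ s → fibreSize f s ≡ 1) →
            ∀ F → ∑[ z < m ] F (f z) ≡ ∑[ s < n ] F s
∑-reindex f fibres≡1 F = trans (∑-fibreSize-* f F)
  (sum-cong-≗ (λ s → trans (cong (_* F s) (fibres≡1 s)) (+-identityʳ (F s))))

injective⇒fibreSize≡1 : ∀ {n} (σ : Fin n → Fin n) → Injective _≡_ _≡_ σ →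
                        ∀ s → fibreSize σ s ≡ 1
injective⇒fibreSize≡1 σ σ-inj = all≡1 (fibreSize σ) (fibreSize≤1 σ σ-inj) (∑-fibreSize σ)

coverage : ∀ {k N} {g : Fin k → ℕ} → ((l : Fin k) → Fin (g l) → Fin N) → Fin N → ℕ
coverage {k} f s = ∑[ l < k ] fibreSize (f l) s

coverage≡1 : ∀ {k N} (g : Fin k → ℕ) → sum g ≡ N → (f : (l : Fin k) → Fin (g l) → Fin N) →
             (∀ l → Injective _≡_ _≡_ (f l)) →
             (∀ l l' → l ≢ l' → ∀ x y → f l x ≢ f l' y) →
             ∀ s → coverage f s ≡ 1
coverage≡1 {k} {N} g Σg≡N f f-inj disjoint = all≡1 (coverage f) coverage≤1 total
  where
  unique : ∀ s l l' → 1 ≤ fibreSize (f l) s → 1 ≤ fibreSize (f l') s → l ≡ l'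
  unique s l l' p q = decidable-stable (l ≟ l') λ l≢l' →
    let x , fx≡s = fibreSize-pos⇒∃ (f l) s p
        y , fy≡s = fibreSize-pos⇒∃ (f l') s q
    in disjoint l l' l≢l' x y (trans fx≡s (sym fy≡s))
  coverage≤1 : ∀ s → coverage f s ≤ 1
  coverage≤1 s = sum≤1 _ (λ l → fibreSize≤1 (f l) (f-inj l) s) (unique s)
  total : ∑[ s < N ] coverage f s ≡ N
  total = trans (∑-comm (λ s l → fibreSize (f l) s))
                (trans (sum-cong-≗ (λ l → ∑-fibreSize (f l))) Σg≡N)

∑-cover : ∀ {k N} {g : Fin k → ℕ} (f : (l : Fin k) → Fin (g l) → Fin N) →
          (∀ s → coverage f s ≡ 1) → ∀ F → ∑[ l < k ] ∑[ z < g l ] F (f l z) ≡ ∑[ s < N ] F s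
∑-cover {k} {N} {g} f cover F = begin
  ∑[ l < k ] ∑[ z < g l ] F (f l z)
    ≡⟨ sum-cong-≗ (λ l → ∑-fibreSize-* (f l) F) ⟩
  ∑[ l < k ] ∑[ s < N ] (fibreSize (f l) s * F s)
    ≡⟨ ∑-comm (λ l s → fibreSize (f l) s * F s) ⟩
  ∑[ s < N ] ∑[ l < k ] (fibreSize (f l) s * F s)
    ≡⟨ sum-cong-≗ (λ s → *-distribʳ-sum (F s) (λ l → fibreSize (f l) s)) ⟨
  ∑[ s < N ] (coverage f s * F s)
    ≡⟨ sum-cong-≗ (λ s → trans (cong (_* F s) (cover s)) (+-identityʳ (F s))) ⟩
  ∑[ s < N ] F s ∎
  where open ≡-Reasoning

record ScaledROS {k : ℕ} (d : ℕ) (p : Fin k → ℕ) : Set where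
  field
    O       : Fin k → Fin k → Fin k → ℕ
    sym₁₂   : ∀ i j l → O i j l ≡ O j i l
    sym₂₃   : ∀ i j l → O i j l ≡ O i l j
    rowsum  : ∀ i j → ∑[ l < k ] O i j l ≡ d * (p i * p j)
    diag    : ∀ i → O i i i ≡ d * (p i * p i)
    offdiag : ∀ i j → i ≢ j → O i i j ≡ 0

symmetrize : ∀ {k} → (Fin k → Fin k → Fin k → ℕ) → Fin k → Fin k → Fin k → ℕ
symmetrize T i j l = T i j l + T i l j + T j i l + T j l i + T l i j + T l j i

∑-distrib-+₆ : ∀ {k} (a b c d e f : Fin k → ℕ) →
  ∑[ l < k ] (a l + b l + c l + d l + e l + f l) ≡ sum a + sum b + sum c + sum d + sum e + sum f
∑-distrib-+₆ a b c d e f =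
  trans (∑-distrib-+ _ f) (cong (_+ sum f) (
  trans (∑-distrib-+ _ e) (cong (_+ sum e) (
  trans (∑-distrib-+ _ d) (cong (_+ sum d) (
  trans (∑-distrib-+ _ c) (cong (_+ sum c) (
  ∑-distrib-+ a b))))))))

symmetrize-scaledROS : ∀ {k} (p : Fin k → ℕ) (T : Fin k → Fin k → Fin k → ℕ) →
  (∀ j l → ∑[ i < k ] T i j l ≡ p j * p l) →
  (∀ i l → ∑[ j < k ] T i j l ≡ p i * p l) →
  (∀ i j → ∑[ l < k ] T i j l ≡ p i * p j) →
  (∀ i → T i i i ≡ p i * p i) →
  ScaledROS 6 p
symmetrize-scaledROS {k} p T ∑₁ ∑₂ ∑₃ T-diag = record
  { O       = symmetrize T
  ; sym₁₂   = λ i j l → swap₁₂ (T i j l) (T i l j) (T j i l) (T j l i) (T l i j) (T l j i)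
  ; sym₂₃   = λ i j l → swap₂₃ (T i j l) (T i l j) (T j i l) (T j l i) (T l i j) (T l j i)
  ; rowsum  = rowsum
  ; diag    = diag
  ; offdiag = λ i j i≢j →
      sum≡term⇒≡0 (symmetrize T i i) i (trans (rowsum i i) (sym (diag i))) j (≢-sym i≢j)
  }
  where
  swap₁₂ : ∀ a b c d e f → a + b + c + d + e + f ≡ c + d + a + b + f + e
  swap₁₂ = solve-∀
  swap₂₃ : ∀ a b c d e f → a + b + c + d + e + f ≡ b + a + e + f + c + d
  swap₂₃ = solve-∀
  six : ∀ x → x + x + x + x + x + x ≡ 6 * x
  six = solve-∀
  diag : ∀ i → symmetrize T i i i ≡ 6 * (p i * p i)
  diag i = trans (six (T i i i)) (cong (6 *_) (T-diag i))
  rowsum : ∀ i j → ∑[ l < k ] symmetrize T i j l ≡ 6 * (p i * p j)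
  rowsum i j
    rewrite ∑-distrib-+₆ (λ l → T i j l) (λ l → T i l j) (λ l → T j i l)
                         (λ l → T j l i) (λ l → T l i j) (λ l → T l j i)
          | ∑₃ i j | ∑₂ i j | ∑₃ j i | ∑₂ j i | ∑₁ i j | ∑₁ j i | *-comm (p j) (p i)
          = six (p i * p j)

module _ {k : ℕ} (T : Fin k → Fin k → Fin k → ℕ) (D : Fin k → ℕ) where

  setDiagonal : Fin k → Fin k → Fin k → ℕ
  setDiagonal i j l with (i ≟ j) ×-dec (j ≟ l)
  ... | yes _ = D i
  ... | no  _ = T i j l

  setDiagonal-diag : ∀ i → setDiagonal i i i ≡ D i
  setDiagonal-diag i with (i ≟ i) ×-dec (i ≟ i)
  ... | yes _ = refl
  ... | no ¬diag = contradiction (refl , refl) ¬diag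

  setDiagonal-off : ∀ {i j l} → ¬ (i ≡ j × j ≡ l) → setDiagonal i j l ≡ T i j l
  setDiagonal-off {i} {j} {l} ¬diag with (i ≟ j) ×-dec (j ≟ l)
  ... | yes diag = contradiction diag ¬diag
  ... | no  _    = refl

  setDiagonal-sym₁₂ : (∀ i j l → T i j l ≡ T j i l) →
                      ∀ i j l → setDiagonal i j l ≡ setDiagonal j i l
  setDiagonal-sym₁₂ T-sym i j l with (i ≟ j) ×-dec (j ≟ l)
  ... | yes (refl , refl) = sym (setDiagonal-diag i)
  ... | no ¬diag =
    trans (T-sym i j l)
          (sym (setDiagonal-off λ (j≡i , i≡l) → ¬diag (sym j≡i , trans j≡i i≡l)))

  setDiagonal-sym₂₃ : (∀ i j l → T i j l ≡ T i l j) →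
                      ∀ i j l → setDiagonal i j l ≡ setDiagonal i l j
  setDiagonal-sym₂₃ T-sym i j l with (i ≟ j) ×-dec (j ≟ l)
  ... | yes (refl , refl) = sym (setDiagonal-diag i)
  ... | no ¬diag =
    trans (T-sym i j l)
          (sym (setDiagonal-off λ (i≡l , l≡j) → ¬diag (trans i≡l l≡j , sym l≡j)))

-- The balance condition says nothing about i ≡ j; the entries O i i l vanish in both
-- structures for l ≢ i, so only the entries O i i i have to be reset.
interpolate : ∀ {k d} {h P Q : Fin k → ℕ} (u v : ℕ) → ScaledROS d P → ScaledROS d Q →
  (∀ i j → i ≢ j → u * (P i * P j) + v * (Q i * Q j) ≡ (u + v) * (h i * h j)) →
  ScaledROS ((u + v) * d) h
interpolate {k} {d} {h} {P} {Q} u v S₁ S₂ balanced = record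
  { O       = setDiagonal T D
  ; sym₁₂   = setDiagonal-sym₁₂ T D λ i j l → cong₂ mix (S₁.sym₁₂ i j l) (S₂.sym₁₂ i j l)
  ; sym₂₃   = setDiagonal-sym₂₃ T D λ i j l → cong₂ mix (S₁.sym₂₃ i j l) (S₂.sym₂₃ i j l)
  ; rowsum  = rowsum
  ; diag    = setDiagonal-diag T D
  ; offdiag = λ i j i≢j → trans (setDiagonal-off T D (i≢j ∘ proj₂)) (T-off i j i≢j)
  }
  where
  module S₁ = ScaledROS S₁
  module S₂ = ScaledROS S₂

  mix : ℕ → ℕ → ℕ
  mix x y = u * x + v * y

  T : Fin k → Fin k → Fin k → ℕ
  T i j l = mix (S₁.O i j l) (S₂.O i j l)

  D : Fin k → ℕ
  D i = (u + v) * d * (h i * h i)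

  T-off : ∀ i j → i ≢ j → T i i j ≡ 0
  T-off i j i≢j =
    cong₂ _+_ (trans (cong (u *_) (S₁.offdiag i j i≢j)) (*-zeroʳ u))
              (trans (cong (v *_) (S₂.offdiag i j i≢j)) (*-zeroʳ v))

  T-rowsum : ∀ i j → i ≢ j → ∑[ l < k ] T i j l ≡ (u + v) * d * (h i * h j)
  T-rowsum i j i≢j = begin
    ∑[ l < k ] T i j l
      ≡⟨ ∑-distrib-+ (λ l → u * S₁.O i j l) (λ l → v * S₂.O i j l) ⟩
    ∑[ l < k ] (u * S₁.O i j l) + ∑[ l < k ] (v * S₂.O i j l)
      ≡⟨ cong₂ _+_ (*-distribˡ-sum u (S₁.O i j)) (*-distribˡ-sum v (S₂.O i j)) ⟨
    mix (sum (S₁.O i j)) (sum (S₂.O i j))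
      ≡⟨ cong₂ mix (S₁.rowsum i j) (S₂.rowsum i j) ⟩
    mix (d * (P i * P j)) (d * (Q i * Q j))
      ≡⟨ factor-d u v d (P i * P j) (Q i * Q j) ⟩
    d * mix (P i * P j) (Q i * Q j)
      ≡⟨ cong (d *_) (balanced i j i≢j) ⟩
    d * ((u + v) * (h i * h j))
      ≡⟨ reorder d (u + v) (h i * h j) ⟩
    (u + v) * d * (h i * h j) ∎
    where
    open ≡-Reasoning
    factor-d : ∀ u v d x y → u * (d * x) + v * (d * y) ≡ d * (u * x + v * y)
    factor-d = solve-∀
    reorder : ∀ d w z → d * (w * z) ≡ w * d * z
    reorder = solve-∀

  rowsum : ∀ i j → ∑[ l < k ] setDiagonal T D i j l ≡ (u + v) * d * (h i * h j)
  rowsum i j = rowsum-by i j (i ≟ j)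
    where
    rowsum-by : ∀ i j → Dec (i ≡ j) →
                ∑[ l < k ] setDiagonal T D i j l ≡ (u + v) * d * (h i * h j)
    rowsum-by i j (no i≢j) =
      trans (sum-cong-≗ (λ l → setDiagonal-off T D {l = l} (i≢j ∘ proj₁))) (T-rowsum i j i≢j)
    rowsum-by i .i (yes refl) = trans
      (∑-single _ i λ l l≢i →
        trans (setDiagonal-off T D (l≢i ∘ sym ∘ proj₂)) (T-off i l (≢-sym l≢i)))
      (setDiagonal-diag T D i)

module _ {k : ℕ} {g : Fin k → ℕ} (X : LS g) where
  open LS X renaming (square to L)

  private
    n : ℕ
    n = sumℕ g

    R : (i : Fin k) → Fin (g i) → Fin n
    R i = rows (sub i)

    C : (j : Fin k) → Fin (g j) → Fin n
    C j = cols (sub j)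

    S : (l : Fin k) → Fin (g l) → Fin n
    S l = syms (sub l)

    partition : (f : (l : Fin k) → Fin (g l) → Fin n) → (∀ l → Injective _≡_ _≡_ (f l)) →
                (∀ l l' → l ≢ l' → ∀ x y → f l x ≢ f l' y) → ∀ s → coverage f s ≡ 1
    partition = coverage≡1 g (sym (sumℕ≡sum g))

  rows-∑ : ∀ F → ∑[ i < k ] ∑[ x < g i ] F (R i x) ≡ ∑[ r < n ] F r
  rows-∑ = ∑-cover R (partition R (rows-inj ∘ sub) λ i i' i≢i' → proj₁ (disjoint i i' i≢i'))

  cols-∑ : ∀ F → ∑[ j < k ] ∑[ y < g j ] F (C j y) ≡ ∑[ c < n ] F c
  cols-∑ = ∑-cover C
    (partition C (cols-inj ∘ sub) λ j j' j≢j' → proj₁ (proj₂ (disjoint j j' j≢j')))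

  syms-coverage : ∀ s → coverage S s ≡ 1
  syms-coverage =
    partition S (syms-inj ∘ sub) λ l l' l≢l' → proj₂ (proj₂ (disjoint l l' l≢l'))

  row-∑ : ∀ r F → ∑[ c < n ] F (L r c) ≡ ∑[ s < n ] F s
  row-∑ r = ∑-reindex (L r) (injective⇒fibreSize≡1 (L r) (proj₁ latin r))

  col-∑ : ∀ c F → ∑[ r < n ] F (L r c) ≡ ∑[ s < n ] F s
  col-∑ c = ∑-reindex (λ r → L r c) (injective⇒fibreSize≡1 (λ r → L r c) (proj₂ latin c))

  -- N(i, j, l) of the proof idea: fibreSize (S l) is the indicator of the symbols of subsquare l
  count : Fin k → Fin k → Fin k → ℕ
  count i j l = ∑[ x < g i ] ∑[ y < g j ] fibreSize (S l) (L (R i x) (C j y))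

  count-∑₁ : ∀ j l → ∑[ i < k ] count i j l ≡ g j * g l
  count-∑₁ j l = begin
    ∑[ i < k ] ∑[ x < g i ] ∑[ y < g j ] fibreSize (S l) (L (R i x) (C j y))
      ≡⟨ rows-∑ (λ r → ∑[ y < g j ] fibreSize (S l) (L r (C j y))) ⟩
    ∑[ r < n ] ∑[ y < g j ] fibreSize (S l) (L r (C j y))
      ≡⟨ ∑-comm (λ r y → fibreSize (S l) (L r (C j y))) ⟩
    ∑[ y < g j ] ∑[ r < n ] fibreSize (S l) (L r (C j y))
      ≡⟨ sum-cong-≗ (λ y → trans (col-∑ (C j y) (fibreSize (S l))) (∑-fibreSize (S l))) ⟩
    ∑[ y < g j ] g l
      ≡⟨ ∑-const (g j) (g l) ⟩
    g j * g l ∎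
    where open ≡-Reasoning

  count-∑₂ : ∀ i l → ∑[ j < k ] count i j l ≡ g i * g l
  count-∑₂ i l = begin
    ∑[ j < k ] ∑[ x < g i ] ∑[ y < g j ] fibreSize (S l) (L (R i x) (C j y))
      ≡⟨ ∑-comm (λ j x → ∑[ y < g j ] fibreSize (S l) (L (R i x) (C j y))) ⟩
    ∑[ x < g i ] ∑[ j < k ] ∑[ y < g j ] fibreSize (S l) (L (R i x) (C j y))
      ≡⟨ sum-cong-≗ (λ x → cols-∑ (λ c → fibreSize (S l) (L (R i x) c))) ⟩
    ∑[ x < g i ] ∑[ c < n ] fibreSize (S l) (L (R i x) c)
      ≡⟨ sum-cong-≗ (λ x → trans (row-∑ (R i x) (fibreSize (S l))) (∑-fibreSize (S l))) ⟩
    ∑[ x < g i ] g l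
      ≡⟨ ∑-const (g i) (g l) ⟩
    g i * g l ∎
    where open ≡-Reasoning

  count-∑₃ : ∀ i j → ∑[ l < k ] count i j l ≡ g i * g j
  count-∑₃ i j = begin
    ∑[ l < k ] ∑[ x < g i ] ∑[ y < g j ] fibreSize (S l) (L (R i x) (C j y))
      ≡⟨ ∑-comm (λ l x → ∑[ y < g j ] fibreSize (S l) (L (R i x) (C j y))) ⟩
    ∑[ x < g i ] ∑[ l < k ] ∑[ y < g j ] fibreSize (S l) (L (R i x) (C j y))
      ≡⟨ sum-cong-≗ (λ x → ∑-comm (λ l y → fibreSize (S l) (L (R i x) (C j y)))) ⟩
    ∑[ x < g i ] ∑[ y < g j ] coverage S (L (R i x) (C j y))
      ≡⟨ sum-cong-≗ (λ x → sum-cong-≗ (λ y → syms-coverage (L (R i x) (C j y)))) ⟩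
    ∑[ x < g i ] ∑[ y < g j ] 1
      ≡⟨ ∑∑-one (g i) (g j) ⟩
    g i * g j ∎
    where open ≡-Reasoning

  count-diag : ∀ i → count i i i ≡ g i * g i
  count-diag i =
    trans (sum-cong-≗ λ x → sum-cong-≗ (cell-in-block x)) (∑∑-one (g i) (g i))
    where
    cell-in-block : ∀ x y → fibreSize (S i) (L (R i x) (C i y)) ≡ 1
    cell-in-block x y = let z , Lxy≡Sz = closed (sub i) x y in
      trans (cong (fibreSize (S i)) Lxy≡Sz) (fibreSize-image (S i) (syms-inj (sub i)) z)

  ls⇒scaledROS : ScaledROS 6 g
  ls⇒scaledROS = symmetrize-scaledROS g count count-∑₁ count-∑₂ count-∑₃ count-diag

-- ℕtoℚ n is fromℚᵘ (ι n) by definition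
ι : ℕ → ℚᵘ
ι n = mkℚᵘ (ℤ.+ n) 0

toℚᵘ-ℕtoℚ : ∀ n → toℚᵘ (ℕtoℚ n) ℚᵘ.≃ ι n
toℚᵘ-ℕtoℚ n = ℚ.toℚᵘ-fromℚᵘ (ι n)

ℕtoℚ-+ : ∀ m n → ℕtoℚ (m + n) ≡ ℕtoℚ m ℚ.+ ℕtoℚ n
ℕtoℚ-+ m n = ℚ.toℚᵘ-injective (begin
  toℚᵘ (ℕtoℚ (m + n))                ≈⟨ toℚᵘ-ℕtoℚ (m + n) ⟩
  ι (m + n)                          ≡⟨ ι-+ ⟩
  ι m ℚᵘ.+ ι n                       ≈⟨ ℚᵘ.+-cong (toℚᵘ-ℕtoℚ m) (toℚᵘ-ℕtoℚ n) ⟨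
  toℚᵘ (ℕtoℚ m) ℚᵘ.+ toℚᵘ (ℕtoℚ n)   ≈⟨ ℚ.toℚᵘ-homo-+ (ℕtoℚ m) (ℕtoℚ n) ⟨
  toℚᵘ (ℕtoℚ m ℚ.+ ℕtoℚ n)           ∎)
  where
  open import Relation.Binary.Reasoning.Setoid ℚᵘ.≃-setoid
  ι-+ : ι (m + n) ≡ ι m ℚᵘ.+ ι n
  ι-+ rewrite ℤₚ.*-identityʳ (ℤ.+ m) | ℤₚ.*-identityʳ (ℤ.+ n) = refl

ℕtoℚ-* : ∀ m n → ℕtoℚ (m * n) ≡ ℕtoℚ m ℚ.* ℕtoℚ n
ℕtoℚ-* m n = ℚ.toℚᵘ-injective (begin
  toℚᵘ (ℕtoℚ (m * n))                ≈⟨ toℚᵘ-ℕtoℚ (m * n) ⟩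
  ι (m * n)                          ≡⟨ cong (λ z → mkℚᵘ z 0) (ℤₚ.pos-* m n) ⟩
  ι m ℚᵘ.* ι n                       ≈⟨ ℚᵘ.*-cong (toℚᵘ-ℕtoℚ m) (toℚᵘ-ℕtoℚ n) ⟨
  toℚᵘ (ℕtoℚ m) ℚᵘ.* toℚᵘ (ℕtoℚ n)   ≈⟨ ℚ.toℚᵘ-homo-* (ℕtoℚ m) (ℕtoℚ n) ⟨
  toℚᵘ (ℕtoℚ m ℚ.* ℕtoℚ n)           ∎)
  where open import Relation.Binary.Reasoning.Setoid ℚᵘ.≃-setoid

sumℚ-ℕtoℚ-*ʳ : ∀ {k} (f : Fin k → ℕ) c →
               sumℚ (λ l → ℕtoℚ (f l) ℚ.* c) ≡ ℕtoℚ (sum f) ℚ.* c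
sumℚ-ℕtoℚ-*ʳ {zero}  f c = sym (ℚ.*-zeroˡ c)
sumℚ-ℕtoℚ-*ʳ {suc k} f c = begin
  ℕtoℚ (f zero) ℚ.* c ℚ.+ sumℚ (λ l → ℕtoℚ (f (suc l)) ℚ.* c)
    ≡⟨ cong (ℕtoℚ (f zero) ℚ.* c ℚ.+_) (sumℚ-ℕtoℚ-*ʳ (f ∘ suc) c) ⟩
  ℕtoℚ (f zero) ℚ.* c ℚ.+ ℕtoℚ (sum (f ∘ suc)) ℚ.* c
    ≡⟨ ℚ.*-distribʳ-+ c (ℕtoℚ (f zero)) (ℕtoℚ (sum (f ∘ suc))) ⟨
  (ℕtoℚ (f zero) ℚ.+ ℕtoℚ (sum (f ∘ suc))) ℚ.* c
    ≡⟨ cong (ℚ._* c) (ℕtoℚ-+ (f zero) (sum (f ∘ suc))) ⟨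
  ℕtoℚ (sum f) ℚ.* c ∎
  where open ≡-Reasoning

ℕtoℚ-nonNeg : ∀ x → ℚ.NonNegative (ℕtoℚ x)
ℕtoℚ-nonNeg x = ℚ.normalize-nonNeg x 1

module _ (d : ℕ) .{{_ : NonZero d}} where

  instance
    ℕtoℚ-pos : ℚ.Positive (ℕtoℚ d)
    ℕtoℚ-pos = ℚ.normalize-pos d 1

    ℕtoℚ-nonZero : ℚ.NonZero (ℕtoℚ d)
    ℕtoℚ-nonZero = ℚ.pos⇒nonZero (ℕtoℚ d)

    1/ℕtoℚ-nonNeg : ℚ.NonNegative (1/ ℕtoℚ d)
    1/ℕtoℚ-nonNeg = ℚ.pos⇒nonNeg (1/ ℕtoℚ d) {{ℚ.1/pos⇒pos (ℕtoℚ d)}}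

  ℕtoℚ-*-cancelˡ : ∀ x → ℕtoℚ (d * x) ℚ.* 1/ ℕtoℚ d ≡ ℕtoℚ x
  ℕtoℚ-*-cancelˡ x = begin
    ℕtoℚ (d * x) ℚ.* 1/ ℕtoℚ d
      ≡⟨ cong (ℚ._* 1/ ℕtoℚ d) (trans (ℕtoℚ-* d x) (ℚ.*-comm (ℕtoℚ d) (ℕtoℚ x))) ⟩
    ℕtoℚ x ℚ.* ℕtoℚ d ℚ.* 1/ ℕtoℚ d
      ≡⟨ ℚ.*-assoc (ℕtoℚ x) (ℕtoℚ d) (1/ ℕtoℚ d) ⟩
    ℕtoℚ x ℚ.* (ℕtoℚ d ℚ.* 1/ ℕtoℚ d)
      ≡⟨ cong (ℕtoℚ x ℚ.*_) (ℚ.*-inverseʳ (ℕtoℚ d)) ⟩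
    ℕtoℚ x ℚ.* ℚ.1ℚ
      ≡⟨ ℚ.*-identityʳ (ℕtoℚ x) ⟩
    ℕtoℚ x ∎
    where open ≡-Reasoning

  scaledROS⇒ROS : ∀ {k} {p : Fin k → ℕ} → ScaledROS d p → ROS p
  scaledROS⇒ROS {k} {p} S = record
    { O       = O
    ; sym₁₂   = λ i j l → cong scale (S.sym₁₂ i j l)
    ; sym₂₃   = λ i j l → cong scale (S.sym₂₃ i j l)
    ; nonneg  = λ i j l → ℚ.nonNegative⁻¹ (O i j l)
                  {{ℚ.nonNeg*nonNeg⇒nonNeg (ℕtoℚ (S.O i j l)) {{ℕtoℚ-nonNeg (S.O i j l)}}
                                           (1/ ℕtoℚ d)}}
    ; rowsum  = λ i j → trans (sumℚ-ℕtoℚ-*ʳ (S.O i j) (1/ ℕtoℚ d))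
                         (trans (cong scale (S.rowsum i j)) (ℕtoℚ-*-cancelˡ (p i * p j)))
    ; diag    = λ i → trans (cong scale (S.diag i)) (ℕtoℚ-*-cancelˡ (p i * p i))
    ; offdiag = λ i j i≢j → trans (cong scale (S.offdiag i j i≢j)) (ℚ.*-zeroˡ (1/ ℕtoℚ d))
    }
    where
    module S = ScaledROS S
    scale : ℕ → ℚ
    scale x = ℕtoℚ x ℚ.* 1/ ℕtoℚ d
    O : Fin k → Fin k → Fin k → ℚ
    O i j l = scale (S.O i j l)

∸-+-balance : ∀ {a x} b → a ≤ x → b * (x ∸ a) + a * (x + b) ≡ (b + a) * x
∸-+-balance {a} b a≤x with t , refl ← m≤n⇒∃[o]m+o≡n a≤x
  rewrite m+n∸m≡n a t = identity a b t
  where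
  identity : ∀ a b t → b * t + a * (a + t + b) ≡ (b + a) * (a + t)
  identity = solve-∀

module _ {k : ℕ} (h : Fin k → ℕ) (m : Fin k) (f g : ℕ → ℕ) (u v : ℕ)
         (balance : u * f (h m) + v * g (h m) ≡ (u + v) * h m) where

  private
    P Q : Fin k → ℕ
    P = updateAt h m f
    Q = updateAt h m g

  updateAt-balance : ∀ i → u * P i + v * Q i ≡ (u + v) * h i
  updateAt-balance i with i ≟ m
  ... | yes refl rewrite updateAt-updates i {f} h | updateAt-updates i {g} h = balance
  ... | no i≢m rewrite updateAt-minimal i m {f} h i≢m | updateAt-minimal i m {g} h i≢m =
    sym (*-distribʳ-+ (h i) u v)

  updateAt-balance-* : ∀ i j → j ≢ m →
                       u * (P i * P j) + v * (Q i * Q j) ≡ (u + v) * (h i * h j)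
  updateAt-balance-* i j j≢m
    rewrite updateAt-minimal j m {f} h j≢m | updateAt-minimal j m {g} h j≢m = begin
    u * (P i * h j) + v * (Q i * h j)   ≡⟨ factor u v (P i) (Q i) (h j) ⟩
    (u * P i + v * Q i) * h j           ≡⟨ cong (_* h j) (updateAt-balance i) ⟩
    (u + v) * h i * h j                 ≡⟨ *-assoc (u + v) (h i) (h j) ⟩
    (u + v) * (h i * h j)               ∎
    where
    open ≡-Reasoning
    factor : ∀ u v x y z → u * (x * z) + v * (y * z) ≡ (u * x + v * y) * z
    factor = solve-∀

  updateAt-balanced : ∀ i j → i ≢ j →
                      u * (P i * P j) + v * (Q i * Q j) ≡ (u + v) * (h i * h j)
  updateAt-balanced i j i≢j with j ≟ m
  ... | no j≢m = updateAt-balance-* i j j≢m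
  ... | yes refl = begin
    u * (P i * P j) + v * (Q i * Q j)
      ≡⟨ cong₂ (λ x y → u * x + v * y) (*-comm (P i) (P j)) (*-comm (Q i) (Q j)) ⟩
    u * (P j * P i) + v * (Q j * Q i)
      ≡⟨ updateAt-balance-* j i i≢j ⟩
    (u + v) * (h j * h i)
      ≡⟨ cong ((u + v) *_) (*-comm (h j) (h i)) ⟩
    (u + v) * (h i * h j) ∎
    where open ≡-Reasoning

ROS-from-updates : ∀ {k} (h : Fin k → ℕ) m (f g : ℕ → ℕ) (u v : ℕ) →
  .{{_ : NonZero (u + v)}} →
  u * f (h m) + v * g (h m) ≡ (u + v) * h m →
  LS (updateAt h m f) → LS (updateAt h m g) → ROS h
ROS-from-updates h m f g u v balance X₁ X₂ =
  scaledROS⇒ROS ((u + v) * 6) {{m*n≢0 (u + v) 6}}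
    (interpolate u v (ls⇒scaledROS X₁) (ls⇒scaledROS X₂) (updateAt-balanced h m f g u v balance))

mainTheorem10 : (k : ℕ) (h : Fin k → ℕ) → (∀ i → 1 ≤ h i) →
    (m : Fin k) (a b : ℕ) → 1 ≤ h m ∸ a →
    LS (updateAt h m (λ x → x ∸ a)) →
    LS (updateAt h m (λ x → x + b)) →
    ROS h
-- For a = 0 the first square is itself an LS(h).
mainTheorem10 k h _ m zero b _ =
  ROS-from-updates h m _ _ 1 0 (+-identityʳ (h m + 0))
mainTheorem10 k h _ m (suc a) b 1≤hm∸a =
  ROS-from-updates h m _ _ b (suc a) {{≢-nonZero (m+1+n≢0 b)}}
    (∸-+-balance b (<⇒≤ (m∸n≢0⇒n<m (n>0⇒n≢0 1≤hm∸a))))
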